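{- Let $G=(V,E)$ be a graph, $x\in\mathbb{R}^E_{\ge0}$, $\eta>2$, and $\mathcal{L}\subseteq 2^V$ a laminar family. Run the following procedure: set $\mathcal{L}'\gets\emptyset$; while $\mathcal{L}$ is nonempty, choose a minimal set $S\in\mathcal{L}$, let $G_S$ be obtained from $G[S]$ by contracting each maximal set of $\mathcal{L}'$ contained in $S$, compute a partition $\mathcal{P}'$ of the vertex set of $G_S$ minimizing $\eta x(\delta_{G_S}(\mathcal{P}'))-(|\mathcal{P}'|-1)$, let $\mathcal{P}$ be the corresponding partition of $S$ obtained by uncontracting, delete $S$ from $\mathcal{L}$, and add all parts of $\mathcal{P}$ to $\mathcal{L}'$; finally output $\mathcal{L}'$. Then the output $\mathcal{L}'$ is a laminar family, and each $S\in\mathcal{L}'$ is $\eta$-well-connected.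
   Context: A family $\mathcal{L}\subseteq 2^V$ is laminar if for all $S,T\in\mathcal{L}$, $S\cap T\in\{\emptyset,S,T\}$. For a graph $H$ and a partition $\mathcal{P}$ of its vertex set, $\delta_H(\mathcal{P})$ is the set of edges of $H$ whose endpoints lie in different parts; $x(F)=\sum_{e\in F}x_e$. $G[S]$ is the induced subgraph on $S$ with edge set $E(S)$. A set $S\subseteq V$ is $\eta$-well-connected (with respect to $x$) if $\eta x(\delta_{G[S]}(\mathcal{Q}))-(|\mathcal{Q}|-1)\ge0$ for every partition $\mathcal{Q}$ of $S$. -}

module Defs where

open import Level using (0ℓ)
open import Data.Nat as ℕ using (ℕ; zero; suc)
open import Data.Bool as Bool using (Bool; true; false; _∧_; not; if_then_else_)
open import Data.Fin using (Fin; zero; suc)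
open import Data.Fin.Subset using (Subset; _∈_; _⊆_; _⊂_; _∩_; Nonempty; Empty) renaming (⊥ to ∅)
open import Data.Vec using (lookup)
open import Data.Vec.Properties using (≡-dec)
open import Data.List as List using (List; []; _∷_; length; filter; _++_)
open import Data.List.Relation.Unary.All using (All)
open import Data.List.Relation.Unary.AllPairs using (AllPairs)
import Data.List.Membership.Propositional as Mem
open import Data.Product using (Σ; _×_; _,_; ∃)
open import Data.Sum using (_⊎_)
open import Relation.Nullary using (¬_; Dec; does)
open import Relation.Binary.PropositionalEquality using (_≡_)
open import Algebra.Structures using (IsCommutativeRing)
open import Relation.Binary.Structures using (IsTotalOrder)

-- Ordered fields (the reals are one; the statement is made for every
-- ordered field, with equality taken to be propositional equality).

record OrderedField : Set₁ where
  infixl 6 _+_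
  infixl 7 _*_
  infix 4 _≤_
  field
    Carrier : Set
    _+_ _*_ : Carrier → Carrier → Carrier
    -_      : Carrier → Carrier
    0# 1#   : Carrier
    _≤_     : Carrier → Carrier → Set
    isCommutativeRing : IsCommutativeRing _≡_ _+_ _*_ -_ 0# 1#
    isTotalOrder      : IsTotalOrder _≡_ _≤_
    0≢1     : ¬ (0# ≡ 1#)
    +-mono  : ∀ a b c → a ≤ b → a + c ≤ b + c
    *-pos   : ∀ a b → 0# ≤ a → 0# ≤ b → 0# ≤ a * b
    inverse : ∀ a → ¬ (a ≡ 0#) → Σ Carrier (λ b → a * b ≡ 1#)

  _-_ : Carrier → Carrier → Carrier
  a - b = a + (- b)

  _<_ : Carrier → Carrier → Set
  a < b = a ≤ b × ¬ (a ≡ b)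

  fromℕ : ℕ → Carrier
  fromℕ zero    = 0#
  fromℕ (suc k) = fromℕ k + 1#

  2# : Carrier
  2# = 1# + 1#

module _ {n : ℕ} where
  open Mem using () renaming (_∈_ to _∈ₗ_)

  Laminar : List (Subset n) → Set
  Laminar L = ∀ S T → S ∈ₗ L → T ∈ₗ L →
    (S ∩ T ≡ ∅) ⊎ (S ∩ T ≡ S) ⊎ (S ∩ T ≡ T)

  IsPartition : Subset n → List (Subset n) → Set
  IsPartition S Q =
    All Nonempty Q ×
    AllPairs (λ A B → Empty (A ∩ B)) Q ×
    All (_⊆ S) Q ×
    (∀ v → v ∈ S → ∃ λ A → A ∈ₗ Q × v ∈ A)

  samePart : List (Subset n) → Fin n → Fin n → Bool
  samePart []      u v = false
  samePart (A ∷ Q) u v = (lookup A u ∧ lookup A v) Bool.∨ samePart Q u v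

  Minimal : Subset n → List (Subset n) → Set
  Minimal S L = S ∈ₗ L × (∀ T → T ∈ₗ L → ¬ (T ⊂ S))

  MaximalIn : Subset n → List (Subset n) → Subset n → Set
  MaximalIn S L' T = T ∈ₗ L' × T ⊆ S × (∀ T' → T' ∈ₗ L' → T' ⊆ S → ¬ (T ⊂ T'))

  remove : Subset n → List (Subset n) → List (Subset n)
  remove S = filter (λ T → Relation.Nullary.¬? (≡-dec Data.Bool._≟_ T S))
    where import Relation.Nullary
          import Data.Bool

sumFin : {A : Set} → A → (A → A → A) → (m : ℕ) → (Fin m → A) → A
sumFin z _⊕_ zero    f = z
sumFin z _⊕_ (suc m) f = f zero ⊕ sumFin z _⊕_ m (λ i → f (suc i))

module WithField (F : OrderedField) where
  open OrderedField F

  module _ {n m : ℕ} (ends : Fin m → Fin n × Fin n) (x : Fin m → Carrier)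
           (η : Carrier) where

    crosses : Subset n → List (Subset n) → Fin m → Bool
    crosses S Q e with ends e
    ... | (u , v) = lookup S u ∧ lookup S v ∧ not (samePart Q u v)

    xδ : Subset n → List (Subset n) → Carrier
    xδ S Q = sumFin 0# _+_ m (λ e → if crosses S Q e then x e else 0#)

    cost : Subset n → List (Subset n) → Carrier
    cost S Q = η * xδ S Q - (fromℕ (length Q) - 1#)

    WellConnected : Subset n → Set
    WellConnected S = ∀ Q → IsPartition S Q → 0# ≤ cost S Q

    -- partitions of S that correspond to partitions of the vertex set of
    -- G_S (G[S] with each maximal set of L' inside S contracted)
    Admissible : List (Subset n) → Subset n → List (Subset n) → Set
    Admissible L' S P =
      IsPartition S P ×
      (∀ T → MaximalIn S L' T → ∃ λ A → A Mem.∈ P × T ⊆ A)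

    Optimal : List (Subset n) → Subset n → List (Subset n) → Set
    Optimal L' S P =
      Admissible L' S P × (∀ Q → Admissible L' S Q → cost S P ≤ cost S Q)

    -- Run L L' out : starting with remaining family L and current L',
    -- some execution of the while-loop terminates with output out.
    data Run : List (Subset n) → List (Subset n) → List (Subset n) → Set where
      done : ∀ {L'} → Run [] L' L'
      step : ∀ {L L' out} (S : Subset n) (P : List (Subset n)) →
             Minimal S L → Optimal L' S P →
             Run (remove S L) (L' ++ P) out → Run L L' out

{-# OPTIONS --safe #-}
-- The loop keeps an invariant: the pending sets are laminar, the output so far is laminar and consists of
-- nonempty well-connected sets, and each output set lies inside or outside each pending set.  When a minimal
-- S is processed, the maximal output sets inside S are contained in parts of the chosen partition P, so the
-- parts of P nest with the old output.  For well-connectedness of a part A, take a partition Q of A and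
-- merge, for each well-connected output set T ⊆ A, the parts of Q meeting T into one part: this splits off a
-- partition of T, whose cost is ≥ 0, so the cost of Q does not go up.  Replacing A in P by the parts of the
-- merged partition gives another admissible partition of S whose cost is cost(P) plus the cost of the merged
-- partition of A, and optimality of P makes the latter, hence cost(Q), nonnegative.
module Submission where

open import Function using (_∘_)
open import Data.Nat as ℕ using (ℕ; zero; suc)
open import Data.Nat.Properties as ℕ using ()
open import Data.Bool using (Bool; true; false; _∧_; not; if_then_else_)
open import Data.Bool.Properties using (∨-zeroʳ)
open import Data.Fin using (Fin; zero; suc)
open import Data.Fin.Subset using (Subset; _⊆_; _⊂_; _⊃_; _∩_; ⋃; Nonempty; Empty) renaming (⊥ to ∅)
open import Data.Fin.Subset.Properties
  using (x∈p∩q⁺; x∈p∩q⁻; x∈p∪q⁺; x∈p∪q⁻; ∉⊥; nonempty?; _∈?_; _⊆?_; _⊂?_;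
         ⊆-refl; ⊆-reflexive; ⊆-trans; ⊆-antisym; p∩q⊆p; p∩q⊆q; Empty-unique)
open import Data.Fin.Subset.Induction using (⊃-wellFounded; Acc; acc)
open import Data.Vec using (lookup)
open import Data.Vec.Properties using ([]=⇒lookup; lookup⇒[]=)
open import Data.List using (List; []; _∷_; length; filter; map; _++_)
open import Data.List.Properties using (length-map; length-++)
open import Data.List.Relation.Unary.All as All using (All; []; _∷_)
import Data.List.Relation.Unary.All.Properties as All
open import Data.List.Relation.Unary.Any as Any using (here; there)
open import Data.List.Relation.Unary.AllPairs as AllPairs using (AllPairs; []; _∷_)
import Data.List.Relation.Unary.AllPairs.Properties as AllPairs
open import Data.List.Membership.Propositional using (find; lose) renaming (_∈_ to _∈ₗ_)
open import Data.List.Membership.Propositional.Properties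
  using (∈-filter⁺; ∈-filter⁻; ∈-map⁺; ∈-++⁺ˡ; ∈-++⁺ʳ; ∈-++⁻; ∈-∃++)
open import Data.Product using (_×_; _,_; ∃; proj₁; proj₂)
open import Data.Sum using (_⊎_; inj₁; inj₂)
open import Data.Empty using (⊥; ⊥-elim)
open import Relation.Nullary using (¬_; yes; no; ¬?; _×-dec_)
open import Relation.Unary using (Decidable)
open import Relation.Binary using (Symmetric)
open import Relation.Binary.PropositionalEquality using (_≡_; refl; sym; trans; cong; cong₂)
open import Relation.Binary.Bundles using (Poset)
open import Relation.Binary.Structures using (IsTotalOrder)
open import Algebra.Bundles using (CommutativeRing)
open import Algebra.Structures using (IsCommutativeRing)
import Relation.Binary.Reasoning.PartialOrder as PartialOrderReasoning
open import Defs

module _ {a} {A : Set a} where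

  All-extract : ∀ {p} {P : A → Set p} xs {x ys} → All P (xs ++ x ∷ ys) → P x × All P (xs ++ ys)
  All-extract []       (px ∷ pys) = px , pys
  All-extract (_ ∷ xs) (py ∷ pxs) with All-extract xs pxs
  ... | px , pxs′ = px , py ∷ pxs′

  AllPairs-extract : ∀ {r} {R : A → A → Set r} → Symmetric R →
    ∀ xs {x ys} → AllPairs R (xs ++ x ∷ ys) → All (R x) (xs ++ ys) × AllPairs R (xs ++ ys)
  AllPairs-extract R-sym []       (rx ∷ pys) = rx , pys
  AllPairs-extract R-sym (_ ∷ xs) (ry ∷ pxs) with All-extract xs ry | AllPairs-extract R-sym xs pxs
  ... | ryx , ry′ | rx , pxs′ = R-sym ryx ∷ rx , ry′ ∷ pxs′

  AllPairs-∈ : ∀ {r} {R : A → A → Set r} {xs x y} → AllPairs R xs → x ∈ₗ xs → y ∈ₗ xs →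
    x ≡ y ⊎ R x y ⊎ R y x
  AllPairs-∈ (_  ∷ _)   (here refl) (here refl) = inj₁ refl
  AllPairs-∈ (rx ∷ _)   (here refl) (there y∈) = inj₂ (inj₁ (All.lookup rx y∈))
  AllPairs-∈ (ry ∷ _)   (there x∈) (here refl) = inj₂ (inj₂ (All.lookup ry x∈))
  AllPairs-∈ (_  ∷ pxs) (there x∈) (there y∈) = AllPairs-∈ pxs x∈ y∈

  ∈-++-∷⁻ : ∀ (xs : List A) {x y ys} → y ∈ₗ xs ++ x ∷ ys → y ≡ x ⊎ y ∈ₗ xs ++ ys
  ∈-++-∷⁻ xs y∈ with ∈-++⁻ xs y∈
  ... | inj₁ y∈xs         = inj₂ (∈-++⁺ˡ y∈xs)
  ... | inj₂ (here refl)  = inj₁ refl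
  ... | inj₂ (there y∈ys) = inj₂ (∈-++⁺ʳ xs y∈ys)

  ∈-++-∷⁺ : ∀ (xs : List A) {x y ys} → y ∈ₗ xs ++ ys → y ∈ₗ xs ++ x ∷ ys
  ∈-++-∷⁺ xs y∈ with ∈-++⁻ xs y∈
  ... | inj₁ y∈xs = ∈-++⁺ˡ y∈xs
  ... | inj₂ y∈ys = ∈-++⁺ʳ xs (there y∈ys)

  length-++-∷ : ∀ (xs : List A) {x ys} → length (xs ++ x ∷ ys) ≡ suc (length (xs ++ ys))
  length-++-∷ []       = refl
  length-++-∷ (_ ∷ xs) = cong suc (length-++-∷ xs)

  length-¬filter+filter : ∀ {p} {P : A → Set p} (P? : Decidable P) xs →
    length xs ≡ length (filter (¬? ∘ P?) xs) ℕ.+ length (filter P? xs)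
  length-¬filter+filter P? []       = refl
  length-¬filter+filter P? (x ∷ xs) with P? x
  ... | yes _ = trans (cong suc (length-¬filter+filter P? xs)) (sym (ℕ.+-suc _ _))
  ... | no  _ = cong suc (length-¬filter+filter P? xs)

module OrderedFieldProperties (F : OrderedField) where
  open OrderedField F
  open IsCommutativeRing isCommutativeRing using (+-assoc; +-comm; +-identityˡ; +-identityʳ; -‿inverseʳ)
  open IsTotalOrder isTotalOrder using (total; antisym) renaming (trans to ≤-trans)

  ring : CommutativeRing _ _
  ring = record { isCommutativeRing = isCommutativeRing }

  poset : Poset _ _ _
  poset = record { isPartialOrder = IsTotalOrder.isPartialOrder isTotalOrder }

  open import Algebra.Properties.AbelianGroup (CommutativeRing.+-abelianGroup ring) using (⁻¹-∙-comm)
  open import Algebra.Properties.Ring (CommutativeRing.ring ring) using (-1*x≈-x; -‿involutive; x[y-z]≈xy-xz)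
  open import Algebra.Properties.CommutativeSemigroup (CommutativeRing.+-commutativeSemigroup ring)
    using (interchange; xy∙z≈y∙xz; xy∙z≈xz∙y; x∙yz≈xz∙y)
  open import Relation.Binary.Reasoning.PartialOrder poset

  +-monoʳ-≤ : ∀ c {a b} → a ≤ b → c + a ≤ c + b
  +-monoʳ-≤ c {a} {b} a≤b = begin
    c + a ≡⟨ +-comm c a ⟩
    a + c ≤⟨ +-mono a b c a≤b ⟩
    b + c ≡⟨ +-comm b c ⟩
    c + b ∎

  +-mono-≤ : ∀ {a b c d} → a ≤ b → c ≤ d → a + c ≤ b + d
  +-mono-≤ {a} {b} {c} a≤b c≤d = ≤-trans (+-mono a b c a≤b) (+-monoʳ-≤ b c≤d)

  x≤x+y : ∀ x {y} → 0# ≤ y → x ≤ x + y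
  x≤x+y x {y} 0≤y = begin
    x      ≡⟨ sym (+-identityʳ x) ⟩
    x + 0# ≤⟨ +-monoʳ-≤ x 0≤y ⟩
    x + y  ∎

  [x+y]-x≡y : ∀ x y → (x + y) - x ≡ y
  [x+y]-x≡y x y = begin-equality
    (x + y) + - x ≡⟨ xy∙z≈y∙xz x y (- x) ⟩
    y + (x - x)   ≡⟨ cong (y +_) (-‿inverseʳ x) ⟩
    y + 0#        ≡⟨ +-identityʳ y ⟩
    y             ∎

  x≤y⇒0≤y-x : ∀ {x y} → x ≤ y → 0# ≤ y - x
  x≤y⇒0≤y-x {x} {y} x≤y = begin
    0#     ≡⟨ -‿inverseʳ x ⟨
    x - x  ≤⟨ +-mono x y (- x) x≤y ⟩
    y - x  ∎

  x≤x+y⇒0≤y : ∀ {x y} → x ≤ x + y → 0# ≤ y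
  x≤x+y⇒0≤y {x} {y} x≤x+y = begin
    0#           ≤⟨ x≤y⇒0≤y-x x≤x+y ⟩
    (x + y) - x  ≡⟨ [x+y]-x≡y x y ⟩
    y            ∎

  *-monoˡ-≤ : ∀ {c a b} → 0# ≤ c → a ≤ b → c * a ≤ c * b
  *-monoˡ-≤ {c} {a} {b} 0≤c a≤b = begin
    c * a                   ≤⟨ x≤x+y (c * a) (*-pos c (b - a) 0≤c (x≤y⇒0≤y-x a≤b)) ⟩
    c * a + c * (b - a)     ≡⟨ cong (c * a +_) (x[y-z]≈xy-xz c b a) ⟩
    c * a + ((c * b) - (c * a)) ≡⟨ +-assoc (c * a) (c * b) (- (c * a)) ⟨
    (c * a + c * b) - (c * a)   ≡⟨ [x+y]-x≡y (c * a) (c * b) ⟩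
    c * b                   ∎

  0≤1 : 0# ≤ 1#
  0≤1 with total 0# 1#
  ... | inj₁ 0≤1 = 0≤1
  ... | inj₂ 1≤0 = ⊥-elim (0≢1 (antisym 0≤1′ 1≤0))
    where
    0≤-1 : 0# ≤ - 1#
    0≤-1 = begin
      0#       ≤⟨ x≤y⇒0≤y-x 1≤0 ⟩
      0# - 1#  ≡⟨ +-identityˡ (- 1#) ⟩
      - 1#     ∎

    0≤1′ : 0# ≤ 1#
    0≤1′ = begin
      0#           ≤⟨ *-pos (- 1#) (- 1#) 0≤-1 0≤-1 ⟩
      - 1# * - 1#  ≡⟨ -1*x≈-x (- 1#) ⟩
      - - 1#       ≡⟨ -‿involutive 1# ⟩
      1#           ∎

  2<x⇒0≤x : ∀ {x} → 2# < x → 0# ≤ x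
  2<x⇒0≤x {x} (2≤x , _) = begin
    0#       ≤⟨ 0≤1 ⟩
    1#       ≡⟨ sym (+-identityˡ 1#) ⟩
    0# + 1#  ≤⟨ +-mono 0# 1# 1# 0≤1 ⟩
    2#       ≤⟨ 2≤x ⟩
    x        ∎

  fromℕ-+ : ∀ a b → fromℕ (a ℕ.+ b) ≡ fromℕ a + fromℕ b
  fromℕ-+ zero    b = sym (+-identityˡ (fromℕ b))
  fromℕ-+ (suc a) b = begin-equality
    fromℕ (a ℕ.+ b) + 1#         ≡⟨ cong (_+ 1#) (fromℕ-+ a b) ⟩
    (fromℕ a + fromℕ b) + 1#     ≡⟨ xy∙z≈xz∙y (fromℕ a) (fromℕ b) 1# ⟩
    (fromℕ a + 1#) + fromℕ b     ∎

  x-[y-1]≡[x+1]-y : ∀ x y → x - (y - 1#) ≡ (x + 1#) - y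
  x-[y-1]≡[x+1]-y x y = begin-equality
    x + - (y + - 1#)      ≡⟨ cong (x +_) (sym (⁻¹-∙-comm y (- 1#))) ⟩
    x + (- y + - - 1#)    ≡⟨ cong (λ z → x + (- y + z)) (-‿involutive 1#) ⟩
    x + (- y + 1#)        ≡⟨ x∙yz≈xz∙y x (- y) 1# ⟩
    (x + 1#) + - y        ∎

  [x-y]+[z-w]≡[x+z]-[y+w] : ∀ x y z w → (x - y) + (z - w) ≡ (x + z) - (y + w)
  [x-y]+[z-w]≡[x+z]-[y+w] x y z w = begin-equality
    (x + - y) + (z + - w) ≡⟨ interchange x (- y) z (- w) ⟩
    (x + z) + (- y + - w) ≡⟨ cong ((x + z) +_) (⁻¹-∙-comm y w) ⟩
    (x + z) - (y + w)     ∎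

  [x+z]-[y+z]≡x-y : ∀ x y z → (x + z) - (y + z) ≡ x - y
  [x+z]-[y+z]≡x-y x y z = begin-equality
    (x + z) - (y + z)     ≡⟨ sym ([x-y]+[z-w]≡[x+z]-[y+w] x y z z) ⟩
    (x - y) + (z - z)     ≡⟨ cong ((x - y) +_) (-‿inverseʳ z) ⟩
    (x - y) + 0#          ≡⟨ +-identityʳ (x - y) ⟩
    x - y                 ∎

  deficit : Carrier → ℕ → Carrier
  deficit a k = a - (fromℕ k - 1#)

  deficit-+ : ∀ a b r k → deficit a (suc r) + deficit b k ≡ deficit (a + b) (r ℕ.+ k)
  deficit-+ a b r k = begin-equality
    (a - ((r′ + 1#) - 1#)) + (b - (k′ - 1#)) ≡⟨ cong₂ _+_ (x-[y-1]≡[x+1]-y a (r′ + 1#)) (x-[y-1]≡[x+1]-y b k′) ⟩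
    ((a + 1#) - (r′ + 1#)) + ((b + 1#) - k′) ≡⟨ [x-y]+[z-w]≡[x+z]-[y+w] (a + 1#) (r′ + 1#) (b + 1#) k′ ⟩
    ((a + 1#) + (b + 1#)) - ((r′ + 1#) + k′) ≡⟨ cong₂ _-_ (trans (interchange a 1# b 1#) (sym (+-assoc (a + b) 1# 1#)))
                                                         (xy∙z≈xz∙y r′ 1# k′) ⟩
    (((a + b) + 1#) + 1#) - ((r′ + k′) + 1#) ≡⟨ [x+z]-[y+z]≡x-y ((a + b) + 1#) (r′ + k′) 1# ⟩
    ((a + b) + 1#) - (r′ + k′)               ≡⟨ x-[y-1]≡[x+1]-y (a + b) (r′ + k′) ⟨
    (a + b) - ((r′ + k′) - 1#)               ≡⟨ cong (λ z → (a + b) - (z - 1#)) (fromℕ-+ r k) ⟨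
    deficit (a + b) (r ℕ.+ k)                ∎
    where
    r′ k′ : Carrier
    r′ = fromℕ r
    k′ = fromℕ k

  sum : (m : ℕ) → (Fin m → Carrier) → Carrier
  sum = sumFin 0# _+_

  sumFin-mono-≤ : ∀ m {f g : Fin m → Carrier} → (∀ i → f i ≤ g i) → sum m f ≤ sum m g
  sumFin-mono-≤ zero    f≤g = IsTotalOrder.refl isTotalOrder
  sumFin-mono-≤ (suc m) f≤g = +-mono-≤ (f≤g zero) (sumFin-mono-≤ m (λ i → f≤g (suc i)))

  sumFin-cong : ∀ m {f g : Fin m → Carrier} → (∀ i → f i ≡ g i) → sum m f ≡ sum m g
  sumFin-cong zero    f≗g = refl
  sumFin-cong (suc m) f≗g = cong₂ _+_ (f≗g zero) (sumFin-cong m (λ i → f≗g (suc i)))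

  sumFin-+ : ∀ m (f g : Fin m → Carrier) → sum m (λ i → f i + g i) ≡ sum m f + sum m g
  sumFin-+ zero    f g = sym (+-identityˡ 0#)
  sumFin-+ (suc m) f g = begin-equality
    (f zero + g zero) + sum m (λ i → f (suc i) + g (suc i))   ≡⟨ cong ((f zero + g zero) +_) (sumFin-+ m _ _) ⟩
    (f zero + g zero) + (sum m (f ∘ suc) + sum m (g ∘ suc))   ≡⟨ interchange (f zero) (g zero) _ _ ⟩
    (f zero + sum m (f ∘ suc)) + (g zero + sum m (g ∘ suc))   ∎

module SubsetFamilies {n : ℕ} where

  open import Data.Fin.Subset using (_∈_)

  Disjoint : Subset n → Subset n → Set
  Disjoint A B = ∀ {v} → v ∈ A → v ∈ B → ⊥

  Disjoint-sym : Symmetric Disjoint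
  Disjoint-sym A∩B=∅ v∈B v∈A = A∩B=∅ v∈A v∈B

  Empty∩⇒Disjoint : ∀ {A B} → Empty (A ∩ B) → Disjoint A B
  Empty∩⇒Disjoint A∩B=∅ v∈A v∈B = A∩B=∅ (_ , x∈p∩q⁺ (v∈A , v∈B))

  Disjoint⇒Empty∩ : ∀ {A B} → Disjoint A B → Empty (A ∩ B)
  Disjoint⇒Empty∩ {A} {B} A∩B=∅ (v , v∈A∩B) = let v∈A , v∈B = x∈p∩q⁻ A B v∈A∩B in A∩B=∅ v∈A v∈B

  Empty∩-sym : Symmetric (λ (A B : Subset n) → Empty (A ∩ B))
  Empty∩-sym = Disjoint⇒Empty∩ ∘ Disjoint-sym ∘ Empty∩⇒Disjoint

  ⊆-¬⊂⇒⊇ : ∀ {A B : Subset n} → A ⊆ B → ¬ (A ⊂ B) → B ⊆ A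
  ⊆-¬⊂⇒⊇ {A} A⊆B A⊄B {v} v∈B with v ∈? A
  ... | yes v∈A = v∈A
  ... | no  v∉A = ⊥-elim (A⊄B (A⊆B , v , v∈B , v∉A))

  ∈⋃⁺ : ∀ {M : List (Subset n)} {B v} → B ∈ₗ M → v ∈ B → v ∈ ⋃ M
  ∈⋃⁺ (here refl) v∈B = x∈p∪q⁺ (inj₁ v∈B)
  ∈⋃⁺ (there B∈)  v∈B = x∈p∪q⁺ (inj₂ (∈⋃⁺ B∈ v∈B))

  ∈⋃⁻ : ∀ (M : List (Subset n)) {v} → v ∈ ⋃ M → ∃ λ B → B ∈ₗ M × v ∈ B
  ∈⋃⁻ []      v∈⋃ = ⊥-elim (∉⊥ v∈⋃)
  ∈⋃⁻ (B ∷ M) v∈⋃ with x∈p∪q⁻ B (⋃ M) v∈⋃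
  ... | inj₁ v∈B = B , here refl , v∈B
  ... | inj₂ v∈⋃M with ∈⋃⁻ M v∈⋃M
  ...   | C , C∈ , v∈C = C , there C∈ , v∈C

  ∈-remove⁻ : ∀ {S T : Subset n} {L} → T ∈ₗ remove S L → T ∈ₗ L
  ∈-remove⁻ = proj₁ ∘ ∈-filter⁻ _

  ∃-maximal : ∀ {p} {P : Subset n → Set p} → Decidable P → ∀ {L A} → A ∈ₗ L → P A →
    ∃ λ T → (T ∈ₗ L × P T × (∀ T′ → T′ ∈ₗ L → P T′ → ¬ (T ⊂ T′))) × A ⊆ T
  ∃-maximal {P = P} P? {L} {A} A∈ PA = go (⊃-wellFounded A) A∈ PA ⊆-refl
    where
    go : ∀ {T} → Acc _⊃_ T → T ∈ₗ L → P T → A ⊆ T →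
      ∃ λ T → (T ∈ₗ L × P T × (∀ T′ → T′ ∈ₗ L → P T′ → ¬ (T ⊂ T′))) × A ⊆ T
    go {T} (acc larger-acc) T∈ PT A⊆T with Any.any? (λ T′ → P? T′ ×-dec (T ⊂? T′)) L
    ... | no ∄larger = T , (T∈ , PT , λ T′ T′∈ PT′ T⊂T′ → ∄larger (lose T′∈ (PT′ , T⊂T′))) , A⊆T
    ... | yes ∃larger with find ∃larger
    ...   | T′ , T′∈ , PT′ , T⊂T′ = go (larger-acc T⊂T′) T′∈ PT′ (⊆-trans A⊆T (proj₁ T⊂T′))

  Nested : Subset n → Subset n → Set
  Nested A B = A ⊆ B ⊎ B ⊆ A ⊎ Disjoint A B

  Nested-sym : Symmetric Nested
  Nested-sym (inj₁ A⊆B)          = inj₂ (inj₁ A⊆B)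
  Nested-sym (inj₂ (inj₁ B⊆A))   = inj₁ B⊆A
  Nested-sym (inj₂ (inj₂ A∩B=∅)) = inj₂ (inj₂ (Disjoint-sym A∩B=∅))

  ∩-trichotomy⇒Nested : ∀ {A B} → (A ∩ B ≡ ∅) ⊎ (A ∩ B ≡ A) ⊎ (A ∩ B ≡ B) → Nested A B
  ∩-trichotomy⇒Nested (inj₁ A∩B≡∅) =
    inj₂ (inj₂ λ v∈A v∈B → ∉⊥ (⊆-reflexive A∩B≡∅ (x∈p∩q⁺ (v∈A , v∈B))))
  ∩-trichotomy⇒Nested {A} {B} (inj₂ (inj₁ A∩B≡A)) = inj₁ (p∩q⊆q A B ∘ ⊆-reflexive (sym A∩B≡A))
  ∩-trichotomy⇒Nested {A} {B} (inj₂ (inj₂ A∩B≡B)) = inj₂ (inj₁ (p∩q⊆p A B ∘ ⊆-reflexive (sym A∩B≡B)))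

  Nested⇒∩-trichotomy : ∀ {A B} → Nested A B → (A ∩ B ≡ ∅) ⊎ (A ∩ B ≡ A) ⊎ (A ∩ B ≡ B)
  Nested⇒∩-trichotomy {A} {B} (inj₁ A⊆B) =
    inj₂ (inj₁ (⊆-antisym (p∩q⊆p A B) λ v∈A → x∈p∩q⁺ (v∈A , A⊆B v∈A)))
  Nested⇒∩-trichotomy {A} {B} (inj₂ (inj₁ B⊆A)) =
    inj₂ (inj₂ (⊆-antisym (p∩q⊆q A B) λ v∈B → x∈p∩q⁺ (B⊆A v∈B , v∈B)))
  Nested⇒∩-trichotomy (inj₂ (inj₂ A∩B=∅)) = inj₁ (Empty-unique (Disjoint⇒Empty∩ A∩B=∅))

  NestedFamily : List (Subset n) → Set
  NestedFamily L = ∀ {A B} → A ∈ₗ L → B ∈ₗ L → Nested A B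

  Laminar⇒NestedFamily : ∀ {L} → Laminar L → NestedFamily L
  Laminar⇒NestedFamily laminar A∈ B∈ = ∩-trichotomy⇒Nested (laminar _ _ A∈ B∈)

  NestedFamily⇒Laminar : ∀ {L} → NestedFamily L → Laminar L
  NestedFamily⇒Laminar nested _ _ A∈ B∈ = Nested⇒∩-trichotomy (nested A∈ B∈)

  NestedFamily-++ : ∀ {L M} → NestedFamily L → NestedFamily M →
    (∀ {A B} → A ∈ₗ L → B ∈ₗ M → Nested A B) → NestedFamily (L ++ M)
  NestedFamily-++ {L} L-nested M-nested across A∈ B∈ with ∈-++⁻ L A∈ | ∈-++⁻ L B∈
  ... | inj₁ A∈L | inj₁ B∈L = L-nested A∈L B∈L
  ... | inj₁ A∈L | inj₂ B∈M = across A∈L B∈M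
  ... | inj₂ A∈M | inj₁ B∈L = Nested-sym (across B∈L A∈M)
  ... | inj₂ A∈M | inj₂ B∈M = M-nested A∈M B∈M

  part-nonempty : ∀ {S : Subset n} {Q B} → IsPartition S Q → B ∈ₗ Q → Nonempty B
  part-nonempty (nonempty , _) = All.lookup nonempty

  part-⊆ : ∀ {S : Subset n} {Q B} → IsPartition S Q → B ∈ₗ Q → B ⊆ S
  part-⊆ (_ , _ , sub , _) = All.lookup sub

  part-covering : ∀ {S : Subset n} {Q v} → IsPartition S Q → v ∈ S → ∃ λ B → B ∈ₗ Q × v ∈ B
  part-covering (_ , _ , _ , cover) = cover _

  parts-disjoint : ∀ {S Q B C} → IsPartition S Q → B ∈ₗ Q → C ∈ₗ Q → B ≡ C ⊎ Disjoint B C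
  parts-disjoint (_ , disjoint , _) B∈ C∈ with AllPairs-∈ disjoint B∈ C∈
  ... | inj₁ B≡C          = inj₁ B≡C
  ... | inj₂ (inj₁ B∩C=∅) = inj₂ (Empty∩⇒Disjoint B∩C=∅)
  ... | inj₂ (inj₂ C∩B=∅) = inj₂ (Disjoint-sym (Empty∩⇒Disjoint C∩B=∅))

  part-apart : ∀ xs {S A : Subset n} {ys C} → IsPartition S (xs ++ A ∷ ys) → C ∈ₗ xs ++ ys → Disjoint A C
  part-apart xs (_ , disjoint , _) C∈ =
    Empty∩⇒Disjoint (All.lookup (proj₁ (AllPairs-extract Empty∩-sym xs disjoint)) C∈)

  partition-nested : ∀ {S Q} → IsPartition S Q → NestedFamily Q
  partition-nested Q-part B∈ C∈ with parts-disjoint Q-part B∈ C∈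
  ... | inj₁ refl  = inj₁ ⊆-refl
  ... | inj₂ B∩C=∅ = inj₂ (inj₂ B∩C=∅)

  SamePart : List (Subset n) → Fin n → Fin n → Set
  SamePart Q u v = ∃ λ B → B ∈ₗ Q × u ∈ B × v ∈ B

  SamePart⇒samePart : ∀ {Q u v} → SamePart Q u v → samePart Q u v ≡ true
  SamePart⇒samePart (B , here refl , u∈B , v∈B) rewrite []=⇒lookup u∈B | []=⇒lookup v∈B = refl
  SamePart⇒samePart {C ∷ Q} {u} {v} (B , there B∈ , u∈B , v∈B)
    rewrite SamePart⇒samePart (B , B∈ , u∈B , v∈B) = ∨-zeroʳ (lookup C u ∧ lookup C v)

  samePart⇒SamePart : ∀ Q {u v} → samePart Q u v ≡ true → SamePart Q u v
  samePart⇒SamePart (B ∷ Q) {u} {v} same with lookup B u in u∈B | lookup B v in v∈B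
  ... | true | true = B , here refl , lookup⇒[]= u B u∈B , lookup⇒[]= v B v∈B
  ... | true | false with samePart⇒SamePart Q same
  ...   | C , C∈ , u∈C , v∈C = C , there C∈ , u∈C , v∈C
  samePart⇒SamePart (B ∷ Q) same | false | _ with samePart⇒SamePart Q same
  ...   | C , C∈ , u∈C , v∈C = C , there C∈ , u∈C , v∈C

  samePart≡false⇒¬SamePart : ∀ {Q u v} → samePart Q u v ≡ false → ¬ SamePart Q u v
  samePart≡false⇒¬SamePart different same with trans (sym (SamePart⇒samePart same)) different
  ... | ()

  ¬SamePart⇒samePart≡false : ∀ Q {u v} → ¬ SamePart Q u v → samePart Q u v ≡ false
  ¬SamePart⇒samePart≡false Q {u} {v} ¬same with samePart Q u v in same
  ... | false = refl
  ... | true  = ⊥-elim (¬same (samePart⇒SamePart Q same))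

  SamePart-++⁻ : ∀ Q {Q′ u v} → SamePart (Q ++ Q′) u v → SamePart Q u v ⊎ SamePart Q′ u v
  SamePart-++⁻ Q (B , B∈ , u∈B , v∈B) with ∈-++⁻ Q B∈
  ... | inj₁ B∈Q  = inj₁ (B , B∈Q , u∈B , v∈B)
  ... | inj₂ B∈Q′ = inj₂ (B , B∈Q′ , u∈B , v∈B)

  Inside : Subset n → List (Subset n) → Set
  Inside T Q = ∃ λ C → C ∈ₗ Q × T ⊆ C

  Refines : List (Subset n) → List (Subset n) → Set
  Refines Q Q′ = ∀ {B} → B ∈ₗ Q → Inside B Q′

  Inside-⊆ : ∀ {T T′ Q} → T ⊆ T′ → Inside T′ Q → Inside T Q
  Inside-⊆ T⊆T′ (C , C∈ , T′⊆C) = C , C∈ , ⊆-trans T⊆T′ T′⊆C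

  Refines-trans : ∀ {Q Q′ Q″} → Refines Q Q′ → Refines Q′ Q″ → Refines Q Q″
  Refines-trans Q≤Q′ Q′≤Q″ B∈ with Q≤Q′ B∈
  ... | C , C∈ , B⊆C = Inside-⊆ B⊆C (Q′≤Q″ C∈)

  Refines⇒SamePart : ∀ {Q Q′ u v} → Refines Q Q′ → SamePart Q u v → SamePart Q′ u v
  Refines⇒SamePart Q≤Q′ (B , B∈ , u∈B , v∈B) with Q≤Q′ B∈
  ... | C , C∈ , B⊆C = C , C∈ , B⊆C u∈B , B⊆C v∈B

  Meets : Subset n → Subset n → Set
  Meets T B = Nonempty (B ∩ T)

  meets? : ∀ T → Decidable (Meets T)
  meets? T B = nonempty? (B ∩ T)

  touching untouched : Subset n → List (Subset n) → List (Subset n)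
  touching  T = filter (meets? T)
  untouched T = filter (¬? ∘ meets? T)

  coarsen : Subset n → List (Subset n) → List (Subset n)
  coarsen T Q = ⋃ (touching T Q) ∷ untouched T Q

  restrict : Subset n → List (Subset n) → List (Subset n)
  restrict T Q = map (_∩ T) (touching T Q)

  coarsen-refines : ∀ T Q → Refines Q (coarsen T Q)
  coarsen-refines T Q {B} B∈ with meets? T B
  ... | yes B∩T≠∅ = ⋃ (touching T Q) , here refl , ∈⋃⁺ (∈-filter⁺ (meets? T) B∈ B∩T≠∅)
  ... | no  B∩T=∅ = B , there (∈-filter⁺ (¬? ∘ meets? T) B∈ B∩T=∅) , ⊆-refl

  ⊆⋃touching : ∀ {A T : Subset n} {Q} → T ⊆ A → IsPartition A Q → T ⊆ ⋃ (touching T Q)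
  ⊆⋃touching {T = T} T⊆A Q-part {v} v∈T with part-covering Q-part (T⊆A v∈T)
  ... | B , B∈ , v∈B = ∈⋃⁺ (∈-filter⁺ (meets? T) B∈ (v , x∈p∩q⁺ (v∈B , v∈T))) v∈B

  coarsen-isPartition : ∀ {A T : Subset n} {Q} → T ⊆ A → IsPartition A Q → Nonempty T →
    IsPartition A (coarsen T Q)
  coarsen-isPartition {A} {T} {Q} T⊆A Q-part@(Q-nonempty , Q-disjoint , Q-sub , _) (t , t∈T) =
      (t , ⊆⋃touching T⊆A Q-part t∈T) ∷ All.filter⁺ (¬? ∘ meets? T) Q-nonempty
    , All.tabulate (Disjoint⇒Empty∩ ∘ ⋃touching-disjoint) ∷ AllPairs.filter⁺ (¬? ∘ meets? T) Q-disjoint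
    , ⋃touching⊆A ∷ All.filter⁺ (¬? ∘ meets? T) Q-sub
    , cover
    where
    ⋃touching⊆A : ⋃ (touching T Q) ⊆ A
    ⋃touching⊆A v∈⋃ with ∈⋃⁻ (touching T Q) v∈⋃
    ... | B , B∈ , v∈B = part-⊆ Q-part (proj₁ (∈-filter⁻ (meets? T) B∈)) v∈B

    ⋃touching-disjoint : ∀ {C} → C ∈ₗ untouched T Q → Disjoint (⋃ (touching T Q)) C
    ⋃touching-disjoint C∈ v∈⋃ v∈C with ∈⋃⁻ (touching T Q) v∈⋃ | ∈-filter⁻ (¬? ∘ meets? T) C∈
    ... | B , B∈ , v∈B | C∈Q , C∩T=∅ with ∈-filter⁻ (meets? T) B∈
    ...   | B∈Q , B∩T≠∅ with parts-disjoint Q-part B∈Q C∈Q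
    ...     | inj₁ refl  = C∩T=∅ B∩T≠∅
    ...     | inj₂ B∩C=∅ = B∩C=∅ v∈B v∈C

    cover : ∀ v → v ∈ A → ∃ λ C → C ∈ₗ coarsen T Q × v ∈ C
    cover v v∈A with part-covering Q-part v∈A
    ... | B , B∈ , v∈B with coarsen-refines T Q B∈
    ...   | C , C∈ , B⊆C = C , C∈ , B⊆C v∈B

  restrict-isPartition : ∀ {A T : Subset n} {Q} → T ⊆ A → IsPartition A Q → IsPartition T (restrict T Q)
  restrict-isPartition {T = T} {Q} T⊆A Q-part@(_ , Q-disjoint , _) =
      All.map⁺ (All.tabulate (proj₂ ∘ ∈-filter⁻ (meets? T) {xs = Q}))
    , AllPairs.map⁺ (AllPairs.map shrink (AllPairs.filter⁺ (meets? T) Q-disjoint))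
    , All.map⁺ (All.tabulate (λ _ → p∩q⊆q _ T))
    , cover
    where
    shrink : ∀ {B C} → Empty (B ∩ C) → Empty ((B ∩ T) ∩ (C ∩ T))
    shrink B∩C=∅ = Disjoint⇒Empty∩ λ v∈B∩T v∈C∩T →
      Empty∩⇒Disjoint B∩C=∅ (p∩q⊆p _ T v∈B∩T) (p∩q⊆p _ T v∈C∩T)

    cover : ∀ v → v ∈ T → ∃ λ C → C ∈ₗ restrict T Q × v ∈ C
    cover v v∈T with part-covering Q-part (T⊆A v∈T)
    ... | B , B∈ , v∈B = B ∩ T , ∈-map⁺ (_∩ T) (∈-filter⁺ (meets? T) B∈ (v , v∈B∩T)) , v∈B∩T
      where
      v∈B∩T : v ∈ B ∩ T
      v∈B∩T = x∈p∩q⁺ (v∈B , v∈T)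

  replace-isPartition : ∀ xs {S A ys Q} → IsPartition S (xs ++ A ∷ ys) → IsPartition A Q →
    IsPartition S ((xs ++ ys) ++ Q)
  replace-isPartition xs {S} {A} {ys} {Q} P-part@(P-nonempty , P-disjoint , P-sub , _) Q-part@(Q-nonempty , Q-disjoint , _)
    with All-extract xs P-sub | AllPairs-extract Empty∩-sym xs P-disjoint
  ... | A⊆S , rest-sub | A-apart , rest-disjoint =
      All.++⁺ (proj₂ (All-extract xs P-nonempty)) Q-nonempty
    , AllPairs.++⁺ rest-disjoint Q-disjoint
        (All.tabulate λ C∈ → All.tabulate λ D∈Q → Disjoint⇒Empty∩ λ v∈C v∈D →
          Empty∩⇒Disjoint (All.lookup A-apart C∈) (part-⊆ Q-part D∈Q v∈D) v∈C)
    , All.++⁺ rest-sub (All.tabulate λ D∈Q → ⊆-trans (part-⊆ Q-part D∈Q) A⊆S)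
    , cover
    where
    cover : ∀ v → v ∈ S → ∃ λ C → C ∈ₗ (xs ++ ys) ++ Q × v ∈ C
    cover v v∈S with part-covering P-part v∈S
    ... | C , C∈ , v∈C with ∈-++-∷⁻ xs C∈
    ...   | inj₂ C∈rest = C , ∈-++⁺ˡ C∈rest , v∈C
    ...   | inj₁ refl with part-covering Q-part v∈C
    ...     | D , D∈ , v∈D = D , ∈-++⁺ʳ (xs ++ ys) D∈ , v∈D

module Analysis (F : OrderedField) {n m : ℕ} (ends : Fin m → Fin n × Fin n)
  (x : Fin m → OrderedField.Carrier F) (η : OrderedField.Carrier F)
  (x≥0 : ∀ e → OrderedField._≤_ F (OrderedField.0# F) (x e))
  (η≥0 : OrderedField._≤_ F (OrderedField.0# F) η) where

  open import Data.Fin.Subset using (_∈_)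
  open SubsetFamilies
  open OrderedField F
  open OrderedFieldProperties F
  open IsCommutativeRing isCommutativeRing using (+-identityˡ; +-identityʳ; distribˡ)
  open IsTotalOrder isTotalOrder using () renaming (refl to ≤-refl; reflexive to ≤-reflexive; trans to ≤-trans)
  open PartialOrderReasoning poset
  private module G = WithField F
  open G using (done; step)

  crosses : Subset n → List (Subset n) → Fin m → Bool
  crosses = G.crosses ends x η

  xδ : Subset n → List (Subset n) → Carrier
  xδ = G.xδ ends x η

  cost : Subset n → List (Subset n) → Carrier
  cost = G.cost ends x η

  WellConnected : Subset n → Set
  WellConnected = G.WellConnected ends x η

  Admissible Optimal : List (Subset n) → Subset n → List (Subset n) → Set
  Admissible = G.Admissible ends x η
  Optimal    = G.Optimal ends x η

  Run : List (Subset n) → List (Subset n) → List (Subset n) → Set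
  Run = G.Run ends x η

  end₁ end₂ : Fin m → Fin n
  end₁ = proj₁ ∘ ends
  end₂ = proj₂ ∘ ends

  Crosses : Subset n → List (Subset n) → Fin m → Set
  Crosses S Q e = end₁ e ∈ S × end₂ e ∈ S × ¬ SamePart Q (end₁ e) (end₂ e)

  crosses-unfold : ∀ S Q e →
    crosses S Q e ≡ lookup S (end₁ e) ∧ lookup S (end₂ e) ∧ not (samePart Q (end₁ e) (end₂ e))
  crosses-unfold S Q e with ends e
  ... | _ = refl

  Crosses⇒crosses : ∀ {S Q e} → Crosses S Q e → crosses S Q e ≡ true
  Crosses⇒crosses {S} {Q} {e} (u∈S , v∈S , ¬same)
    rewrite crosses-unfold S Q e | []=⇒lookup u∈S | []=⇒lookup v∈S | ¬SamePart⇒samePart≡false Q ¬same = refl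

  crosses⇒Crosses : ∀ {S Q e} → crosses S Q e ≡ true → Crosses S Q e
  crosses⇒Crosses {S} {Q} {e} crossing
    with lookup S (end₁ e) in u∈S | lookup S (end₂ e) in v∈S | samePart Q (end₁ e) (end₂ e) in same
       | trans (sym (crosses-unfold S Q e)) crossing
  ... | true | true | false | _ = lookup⇒[]= _ S u∈S , lookup⇒[]= _ S v∈S , samePart≡false⇒¬SamePart same
  ... | true | true | true | ()
  ... | true | false | _ | ()
  ... | false | _ | _ | ()

  weight : Bool → Fin m → Carrier
  weight b e = if b then x e else 0#

  weight-+-≤ : ∀ e {b b₁ b₂} → (b₁ ≡ true → b ≡ true) → (b₂ ≡ true → b ≡ true) →
    (b₁ ≡ true → b₂ ≡ true → ⊥) → weight b₁ e + weight b₂ e ≤ weight b e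
  weight-+-≤ e {_}     {true}  {true}  _     _     excl = ⊥-elim (excl refl refl)
  weight-+-≤ e {_}     {true}  {false} b₁⇒b  _     _    rewrite b₁⇒b refl = ≤-reflexive (+-identityʳ (x e))
  weight-+-≤ e {_}     {false} {true}  _     b₂⇒b  _    rewrite b₂⇒b refl = ≤-reflexive (+-identityˡ (x e))
  weight-+-≤ e {false} {false} {false} _     _     _    = ≤-reflexive (+-identityʳ 0#)
  weight-+-≤ e {true}  {false} {false} _     _     _    = ≤-trans (≤-reflexive (+-identityʳ 0#)) (x≥0 e)

  weight-+-≡ : ∀ e {b b₁ b₂} → (b ≡ true → b₁ ≡ true ⊎ b₂ ≡ true) → (b₁ ≡ true → b ≡ true) →
    (b₂ ≡ true → b ≡ true) → (b₁ ≡ true → b₂ ≡ true → ⊥) → weight b e ≡ weight b₁ e + weight b₂ e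
  weight-+-≡ e {_}     {true}  {true}  _     _    _    excl = ⊥-elim (excl refl refl)
  weight-+-≡ e {_}     {true}  {false} _     b₁⇒b _    _    rewrite b₁⇒b refl = sym (+-identityʳ (x e))
  weight-+-≡ e {_}     {false} {true}  _     _    b₂⇒b _    rewrite b₂⇒b refl = sym (+-identityˡ (x e))
  weight-+-≡ e {false} {false} {false} _     _    _    _    = sym (+-identityʳ 0#)
  weight-+-≡ e {true}  {false} {false} split _    _    _    with split refl
  ... | inj₁ ()
  ... | inj₂ ()

  module _ {S Q S₁ Q₁ S₂ Q₂}
    (crosses₁ : ∀ {e} → Crosses S₁ Q₁ e → Crosses S Q e)
    (crosses₂ : ∀ {e} → Crosses S₂ Q₂ e → Crosses S Q e)
    (exclusive : ∀ {e} → Crosses S₁ Q₁ e → Crosses S₂ Q₂ e → ⊥) where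

    xδ-+-≤ : xδ S₁ Q₁ + xδ S₂ Q₂ ≤ xδ S Q
    xδ-+-≤ = begin
      xδ S₁ Q₁ + xδ S₂ Q₂                                           ≡⟨ sumFin-+ m _ _ ⟨
      sum m (λ e → weight (crosses S₁ Q₁ e) e + weight (crosses S₂ Q₂ e) e) ≤⟨ sumFin-mono-≤ m edge ⟩
      xδ S Q                                                        ∎
      where
      edge : ∀ e → weight (crosses S₁ Q₁ e) e + weight (crosses S₂ Q₂ e) e ≤ weight (crosses S Q e) e
      edge e = weight-+-≤ e (Crosses⇒crosses ∘ crosses₁ ∘ crosses⇒Crosses)
        (Crosses⇒crosses ∘ crosses₂ ∘ crosses⇒Crosses)
        (λ c₁ c₂ → exclusive (crosses⇒Crosses c₁) (crosses⇒Crosses c₂))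

    xδ-+-≡ : (∀ {e} → Crosses S Q e → Crosses S₁ Q₁ e ⊎ Crosses S₂ Q₂ e) → xδ S Q ≡ xδ S₁ Q₁ + xδ S₂ Q₂
    xδ-+-≡ split = trans (sumFin-cong m edge) (sumFin-+ m _ _)
      where
      split′ : ∀ {e} → crosses S Q e ≡ true → crosses S₁ Q₁ e ≡ true ⊎ crosses S₂ Q₂ e ≡ true
      split′ c with split (crosses⇒Crosses c)
      ... | inj₁ c₁ = inj₁ (Crosses⇒crosses c₁)
      ... | inj₂ c₂ = inj₂ (Crosses⇒crosses c₂)

      edge : ∀ e → weight (crosses S Q e) e ≡ weight (crosses S₁ Q₁ e) e + weight (crosses S₂ Q₂ e) e
      edge e = weight-+-≡ e split′ (Crosses⇒crosses ∘ crosses₁ ∘ crosses⇒Crosses)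
        (Crosses⇒crosses ∘ crosses₂ ∘ crosses⇒Crosses)
        (λ c₁ c₂ → exclusive (crosses⇒Crosses c₁) (crosses⇒Crosses c₂))

  -- Defs gives _-_ no fixity, so it binds tighter than _*_: cost S Q is η * deficit (xδ S Q) (length Q).
  cost-+ : ∀ a b r k → η * deficit a (suc r) + η * deficit b k ≡ η * deficit (a + b) (r ℕ.+ k)
  cost-+ a b r k = trans (sym (distribˡ η _ _)) (cong (η *_) (deficit-+ a b r k))

  -- Merging the parts that meet a well-connected set

  module _ {A T : Subset n} {Q : List (Subset n)} (T⊆A : T ⊆ A) (Q-part : IsPartition A Q) where

    xδ-coarsen+restrict≤ : xδ A (coarsen T Q) + xδ T (restrict T Q) ≤ xδ A Q
    xδ-coarsen+restrict≤ = xδ-+-≤ coarse-crossing fine-crossing exclusive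
      where
      coarse-crossing : ∀ {e} → Crosses A (coarsen T Q) e → Crosses A Q e
      coarse-crossing (u∈A , v∈A , ¬same) = u∈A , v∈A , ¬same ∘ Refines⇒SamePart (coarsen-refines T Q)

      fine-crossing : ∀ {e} → Crosses T (restrict T Q) e → Crosses A Q e
      fine-crossing (u∈T , v∈T , ¬same) = T⊆A u∈T , T⊆A v∈T , λ (B , B∈ , u∈B , v∈B) →
        ¬same (B ∩ T , ∈-map⁺ (_∩ T) (∈-filter⁺ (meets? T) B∈ (_ , x∈p∩q⁺ (u∈B , u∈T)))
              , x∈p∩q⁺ (u∈B , u∈T) , x∈p∩q⁺ (v∈B , v∈T))

      exclusive : ∀ {e} → Crosses A (coarsen T Q) e → Crosses T (restrict T Q) e → ⊥
      exclusive (_ , _ , ¬same) (u∈T , v∈T , _) =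
        ¬same (⋃ (touching T Q) , here refl , ⊆⋃touching T⊆A Q-part u∈T , ⊆⋃touching T⊆A Q-part v∈T)

    cost-coarsen≤ : WellConnected T → cost A (coarsen T Q) ≤ cost A Q
    cost-coarsen≤ T-wc = begin
      cost A (coarsen T Q)
        ≤⟨ x≤x+y _ T-restrict-cost≥0 ⟩
      cost A (coarsen T Q) + cost T (restrict T Q)
        ≡⟨ cong (λ l → cost A (coarsen T Q) + η * deficit (xδ T (restrict T Q)) l) (length-map (_∩ T) (touching T Q)) ⟩
      η * deficit (xδ A (coarsen T Q)) (suc r) + η * deficit (xδ T (restrict T Q)) k
        ≡⟨ cost-+ _ _ r k ⟩
      η * deficit (xδ A (coarsen T Q) + xδ T (restrict T Q)) (r ℕ.+ k)
        ≤⟨ *-monoˡ-≤ η≥0 (+-mono _ _ _ xδ-coarsen+restrict≤) ⟩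
      η * deficit (xδ A Q) (r ℕ.+ k)
        ≡⟨ cong (λ l → η * deficit (xδ A Q) l) (length-¬filter+filter (meets? T) Q) ⟨
      cost A Q
        ∎
      where
      r k : ℕ
      r = length (untouched T Q)
      k = length (touching T Q)

      T-restrict-cost≥0 : 0# ≤ cost T (restrict T Q)
      T-restrict-cost≥0 = T-wc (restrict T Q) (restrict-isPartition T⊆A Q-part)

  NonemptyWellConnected : Subset n → Set
  NonemptyWellConnected T = Nonempty T × WellConnected T

  record Coarsening (A : Subset n) (Ts Q : List (Subset n)) : Set where
    field
      parts       : List (Subset n)
      isPartition : IsPartition A parts
      cost≤       : cost A parts ≤ cost A Q
      refines     : Refines Q parts
      absorbs     : ∀ {T} → T ∈ₗ Ts → T ⊆ A → Inside T parts

  coarsening : ∀ {A} Ts {Q} → (∀ {T} → T ∈ₗ Ts → NonemptyWellConnected T) → IsPartition A Q →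
    Coarsening A Ts Q
  coarsening [] {Q} _ Q-part = record
    { parts = Q ; isPartition = Q-part ; cost≤ = ≤-refl ; refines = λ B∈ → _ , B∈ , ⊆-refl ; absorbs = λ () }
  coarsening {A} (T ∷ Ts) {Q} good Q-part with T ⊆? A
  ... | no T⊈A = record { C hiding (absorbs) ; absorbs = absorbs }
    where
    module C = Coarsening (coarsening Ts (good ∘ there) Q-part)
    absorbs : ∀ {T′} → T′ ∈ₗ T ∷ Ts → T′ ⊆ A → Inside T′ C.parts
    absorbs (here refl) T⊆A = ⊥-elim (T⊈A T⊆A)
    absorbs (there T′∈) = C.absorbs T′∈
  ... | yes T⊆A = record
    { parts       = C.parts
    ; isPartition = C.isPartition
    ; cost≤       = ≤-trans C.cost≤ (cost-coarsen≤ T⊆A Q-part (proj₂ (good (here refl))))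
    ; refines     = Refines-trans (coarsen-refines T Q) C.refines
    ; absorbs     = absorbs
    }
    where
    module C = Coarsening (coarsening Ts (good ∘ there) (coarsen-isPartition T⊆A Q-part (proj₁ (good (here refl)))))
    absorbs : ∀ {T′} → T′ ∈ₗ T ∷ Ts → T′ ⊆ A → Inside T′ C.parts
    absorbs (here refl) _ = Inside-⊆ (⊆⋃touching T⊆A Q-part) (C.refines (here refl))
    absorbs (there T′∈)  = C.absorbs T′∈

  -- Replacing a part by a partition of it

  module _ (xs : List (Subset n)) {S A ys Q} (P-part : IsPartition S (xs ++ A ∷ ys)) (Q-part : IsPartition A Q) where
    private
      P P* : List (Subset n)
      P  = xs ++ A ∷ ys
      P* = (xs ++ ys) ++ Q

      A∈P : A ∈ₗ P
      A∈P = ∈-++⁺ʳ xs (here refl)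

      A⊆S : A ⊆ S
      A⊆S = part-⊆ P-part A∈P

      SamePart-A : ∀ {u v} → u ∈ A → v ∈ A → SamePart P u v
      SamePart-A u∈A v∈A = A , A∈P , u∈A , v∈A

    xδ-replace : xδ S P* ≡ xδ S P + xδ A Q
    xδ-replace = xδ-+-≡ outer-crossing inner-crossing exclusive split
      where
      outer-crossing : ∀ {e} → Crosses S P e → Crosses S P* e
      outer-crossing (u∈S , v∈S , ¬same) = u∈S , v∈S , λ same → ¬same (case (SamePart-++⁻ (xs ++ ys) same))
        where
        case : ∀ {u v} → SamePart (xs ++ ys) u v ⊎ SamePart Q u v → SamePart P u v
        case (inj₁ (C , C∈ , u∈C , v∈C)) = C , ∈-++-∷⁺ xs C∈ , u∈C , v∈C
        case (inj₂ (D , D∈ , u∈D , v∈D)) = SamePart-A (part-⊆ Q-part D∈ u∈D) (part-⊆ Q-part D∈ v∈D)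

      inner-crossing : ∀ {e} → Crosses A Q e → Crosses S P* e
      inner-crossing (u∈A , v∈A , ¬same) = A⊆S u∈A , A⊆S v∈A , λ same → case (SamePart-++⁻ (xs ++ ys) same)
        where
        case : SamePart (xs ++ ys) _ _ ⊎ SamePart Q _ _ → ⊥
        case (inj₁ (C , C∈ , u∈C , _)) = part-apart xs P-part C∈ u∈A u∈C
        case (inj₂ same) = ¬same same

      exclusive : ∀ {e} → Crosses S P e → Crosses A Q e → ⊥
      exclusive (_ , _ , ¬same) (u∈A , v∈A , _) = ¬same (SamePart-A u∈A v∈A)

      not-inside-A : ∀ {e} → Crosses S P* e → (end₁ e ∈ A → end₂ e ∈ A → ⊥) → Crosses S P e
      not-inside-A (u∈S , v∈S , ¬same) ¬both =
        u∈S , v∈S , λ (C , C∈ , u∈C , v∈C) → case (∈-++-∷⁻ xs C∈) u∈C v∈C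
        where
        case : ∀ {C} → C ≡ A ⊎ C ∈ₗ xs ++ ys → _ ∈ C → _ ∈ C → ⊥
        case (inj₁ refl)    u∈A v∈A = ¬both u∈A v∈A
        case (inj₂ C∈rest) u∈C v∈C = ¬same (_ , ∈-++⁺ˡ C∈rest , u∈C , v∈C)

      split : ∀ {e} → Crosses S P* e → Crosses S P e ⊎ Crosses A Q e
      split {e} crossing@(_ , _ , ¬same) with end₁ e ∈? A | end₂ e ∈? A
      ... | yes u∈A | yes v∈A =
        inj₂ (u∈A , v∈A , λ (D , D∈ , u∈D , v∈D) → ¬same (D , ∈-++⁺ʳ (xs ++ ys) D∈ , u∈D , v∈D))
      ... | yes _   | no  v∉A = inj₁ (not-inside-A crossing λ _ v∈A → v∉A v∈A)
      ... | no  u∉A | _       = inj₁ (not-inside-A crossing λ u∈A _ → u∉A u∈A)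

    cost-replace : cost S P* ≡ cost S P + cost A Q
    cost-replace = begin-equality
      cost S P*
        ≡⟨ cong₂ (λ a l → η * deficit a l) xδ-replace (length-++ (xs ++ ys)) ⟩
      η * deficit (xδ S P + xδ A Q) (length (xs ++ ys) ℕ.+ length Q)
        ≡⟨ cost-+ _ _ (length (xs ++ ys)) (length Q) ⟨
      η * deficit (xδ S P) (suc (length (xs ++ ys))) + cost A Q
        ≡⟨ cong (λ l → η * deficit (xδ S P) l + cost A Q) (length-++-∷ xs) ⟨
      cost S P + cost A Q
        ∎

    replace-Inside : ∀ {T} → Inside T P → (T ⊆ A → Inside T Q) → Inside T P*
    replace-Inside (C , C∈ , T⊆C) inside-Q with ∈-++-∷⁻ xs C∈
    ... | inj₂ C∈rest = C , ∈-++⁺ˡ C∈rest , T⊆C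
    ... | inj₁ refl with inside-Q T⊆C
    ...   | D , D∈ , T⊆D = D , ∈-++⁺ʳ (xs ++ ys) D∈ , T⊆D

  part-wellConnected : ∀ {L′ S P A} → (∀ {T} → T ∈ₗ L′ → NonemptyWellConnected T) →
    Optimal L′ S P → A ∈ₗ P → WellConnected A
  part-wellConnected {L′} {S} {A = A} L′-good ((P-part , P-admissible) , P-optimal) A∈ Q Q-part
    with ∈-∃++ A∈
  ... | xs , ys , refl = begin
    0#            ≤⟨ x≤x+y⇒0≤y P≤P+Q* ⟩
    cost A Q*.parts ≤⟨ Q*.cost≤ ⟩
    cost A Q      ∎
    where
    module Q* = Coarsening (coarsening L′ L′-good Q-part)

    P*-admissible : Admissible L′ S ((xs ++ ys) ++ Q*.parts)
    P*-admissible = replace-isPartition xs P-part Q*.isPartition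
                  , λ T T-max → replace-Inside xs P-part Q*.isPartition (P-admissible T T-max)
                                               (Q*.absorbs (proj₁ T-max))

    P≤P+Q* : cost S (xs ++ A ∷ ys) ≤ cost S (xs ++ A ∷ ys) + cost A Q*.parts
    P≤P+Q* = begin
      cost S (xs ++ A ∷ ys)                     ≤⟨ P-optimal _ P*-admissible ⟩
      cost S ((xs ++ ys) ++ Q*.parts)           ≡⟨ cost-replace xs P-part Q*.isPartition ⟩
      cost S (xs ++ A ∷ ys) + cost A Q*.parts   ∎

  -- The loop invariant

  record Invariant (L L′ : List (Subset n)) : Set where
    field
      pending-nested : NestedFamily L
      output-nested  : NestedFamily L′
      output-good    : ∀ {A} → A ∈ₗ L′ → NonemptyWellConnected A
      output-placed  : ∀ {A S} → A ∈ₗ L′ → S ∈ₗ L → A ⊆ S ⊎ Disjoint A S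

  initial-invariant : ∀ {L} → Laminar L → Invariant L []
  initial-invariant L-laminar = record
    { pending-nested = Laminar⇒NestedFamily L-laminar
    ; output-nested  = λ ()
    ; output-good    = λ ()
    ; output-placed  = λ ()
    }

  step-invariant : ∀ {L L′ S P} → Minimal S L → Optimal L′ S P → Invariant L L′ →
    Invariant (remove S L) (L′ ++ P)
  step-invariant {L} {L′} {S} {P} (S∈L , S-minimal) P-optimal@((P-part , P-admissible) , _) inv = record
    { pending-nested = λ T∈ T′∈ → pending-nested (∈-remove⁻ T∈) (∈-remove⁻ T′∈)
    ; output-nested  = NestedFamily-++ output-nested (partition-nested P-part) old-nested-new
    ; output-good    = good
    ; output-placed  = placed
    }
    where
    open Invariant inv

    old-nested-new : ∀ {A B} → A ∈ₗ L′ → B ∈ₗ P → Nested A B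
    old-nested-new A∈ B∈ with output-placed A∈ S∈L
    ... | inj₂ A∩S=∅ = inj₂ (inj₂ λ v∈A v∈B → A∩S=∅ v∈A (part-⊆ P-part B∈ v∈B))
    ... | inj₁ A⊆S with ∃-maximal (_⊆? S) A∈ A⊆S
    ...   | T , T-max , A⊆T with P-admissible T T-max
    ...     | C , C∈ , T⊆C with parts-disjoint P-part B∈ C∈
    ...       | inj₁ refl    = inj₁ (⊆-trans A⊆T T⊆C)
    ...       | inj₂ B∩C=∅   = inj₂ (inj₂ λ v∈A v∈B → B∩C=∅ v∈B (T⊆C (A⊆T v∈A)))

    good : ∀ {A} → A ∈ₗ L′ ++ P → NonemptyWellConnected A
    good A∈ with ∈-++⁻ L′ A∈
    ... | inj₁ A∈L′ = output-good A∈L′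
    ... | inj₂ A∈P  = part-nonempty P-part A∈P , part-wellConnected output-good P-optimal A∈P

    placed : ∀ {A S′} → A ∈ₗ L′ ++ P → S′ ∈ₗ remove S L → A ⊆ S′ ⊎ Disjoint A S′
    placed A∈ S′∈ with ∈-++⁻ L′ A∈ | pending-nested S∈L (∈-remove⁻ S′∈)
    ... | inj₁ A∈L′ | _                   = output-placed A∈L′ (∈-remove⁻ S′∈)
    ... | inj₂ A∈P  | inj₁ S⊆S′           = inj₁ (⊆-trans (part-⊆ P-part A∈P) S⊆S′)
    ... | inj₂ A∈P  | inj₂ (inj₂ S∩S′=∅)  = inj₂ λ v∈A v∈S′ → S∩S′=∅ (part-⊆ P-part A∈P v∈A) v∈S′
    ... | inj₂ A∈P  | inj₂ (inj₁ S′⊆S)    =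
      inj₁ (⊆-trans (part-⊆ P-part A∈P) (⊆-¬⊂⇒⊇ S′⊆S (S-minimal _ (∈-remove⁻ S′∈))))

  run-invariant : ∀ {L L′ out} → Run L L′ out → Invariant L L′ →
    NestedFamily out × (∀ {A} → A ∈ₗ out → WellConnected A)
  run-invariant done                         inv = Invariant.output-nested inv , proj₂ ∘ Invariant.output-good inv
  run-invariant (step _ _ S-min P-opt run) inv = run-invariant run (step-invariant S-min P-opt inv)

open import Data.List.Membership.Propositional using (_∈_)

mainTheorem8 : (F : OrderedField) → let open WithField F in
    ∀ {n m : ℕ} (ends : Fin m → Fin n × Fin n) (x : Fin m → OrderedField.Carrier F) (η : OrderedField.Carrier F) →
    (∀ e → OrderedField._≤_ F (OrderedField.0# F) (x e)) → OrderedField._<_ F (OrderedField.2# F) η →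
    (L : List (Subset n)) → Laminar L →
    (out : List (Subset n)) → Run ends x η L [] out →
    Laminar out × (∀ S → S ∈ out → WellConnected ends x η S)
mainTheorem8 F ends x η x≥0 2<η L L-laminar out run =
  NestedFamily⇒Laminar (proj₁ at-end) , λ _ → proj₂ at-end
  where
  open SubsetFamilies
  open Analysis F ends x η x≥0 (OrderedFieldProperties.2<x⇒0≤x F 2<η)

  at-end : NestedFamily out × (∀ {A} → A ∈ out → WellConnected A)
  at-end = run-invariant run (initial-invariant L-laminar)
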